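{- The Diophantine equation $3^{x}-2^{x}=L_{r}$ in nonnegative integers $r,x$ has only the solution $(r,x)=(1,1)$.
   Context: $(L_n)_{n\ge0}$ is the Lucas sequence: $L_0=2$, $L_1=1$, $L_n=L_{n-1}+L_{n-2}$ for $n\ge 2$. -}

module Defs where

open import Data.Nat using (ℕ; zero; suc; _+_)

L : ℕ → ℕ
L zero = 2
L (suc zero) = 1
L (suc (suc n)) = L (suc n) + L n

module Submission where

-- The proof is a congruence sieve modulo 276 = 4 · 3 · 23.  For x ≥ 2 a solution
-- gives L r + 2^x = 3^x, hence L r + 2^x ≡ 3^x (mod 276).  Modulo 276 the Lucas
-- sequence is periodic with period 48, and for exponents x ≥ 2 the powers 2^x and
-- 3^x are periodic with period 22 (because 2^24 ≡ 2^2 and 3^24 ≡ 3^2).  So the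
-- congruence depends only on r mod 48 and x mod 22, and a finite check of these
-- 48 · 22 residue classes shows that it never holds.  For x = 0 the equation says
-- L r = 0, impossible as Lucas numbers are positive; for x = 1 it says L r = 1,
-- which forces r = 1.

open import Defs
open import Data.Nat using (ℕ; zero; suc; _+_; _*_; _∸_; _^_; _≤_; _%_; _/_; _≟_; NonZero; s≤s; z≤n)
open import Data.Nat.Properties using (+-comm; +-assoc; ≤-trans; m≤m+n; +-mono-≤; m∸n+n≡m; ^-monoˡ-≤; ^-distribˡ-+-*)
open import Data.Nat.DivMod using (m≡m%n+[m/n]*n; m%n<n; %-distribˡ-+; %-distribˡ-*)
open import Data.Nat.GeneralisedArithmetic using (fold)
open import Data.Fin using (Fin; toℕ; fromℕ<)
open import Data.Fin.Properties using (all?; toℕ-fromℕ<)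
open import Data.Product using (_×_; _,_; proj₁; proj₂)
open import Function.Bundles using (_⇔_; mk⇔)
open import Relation.Nullary using (¬?; contradiction)
open import Relation.Nullary.Decidable using (from-yes)
open import Relation.Binary.PropositionalEquality using (_≡_; _≢_; refl; sym; trans; cong; cong₂; subst)
open Relation.Binary.PropositionalEquality.≡-Reasoning

module _ (f : ℕ → ℕ) (p : ℕ) .{{_ : NonZero p}} (periodic : ∀ n → f (n + p) ≡ f n) where

  periodic-multiple : ∀ r q → f (r + q * p) ≡ f r
  periodic-multiple r zero = cong f (+-comm r 0)
  periodic-multiple r (suc q) = begin
    f (r + (p + q * p)) ≡⟨ cong (λ k → f (r + k)) (+-comm p (q * p)) ⟩
    f (r + (q * p + p)) ≡⟨ cong f (sym (+-assoc r (q * p) p)) ⟩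
    f (r + q * p + p)   ≡⟨ periodic (r + q * p) ⟩
    f (r + q * p)       ≡⟨ periodic-multiple r q ⟩
    f r                 ∎

  periodic-mod : ∀ n → f n ≡ f (n % p)
  periodic-mod n = trans (cong f (m≡m%n+[m/n]*n n p)) (periodic-multiple (n % p) (n / p))

lucasStep : (m : ℕ) .{{_ : NonZero m}} → ℕ × ℕ → ℕ × ℕ
lucasStep m (a , b) = (b , (b + a) % m)

-- The pairs (L n mod m , L (n+1) mod m), computed by iterating lucasStep so that only
-- residues below m are ever formed; lucasMod is their first component.
lucasPairs : (m : ℕ) .{{_ : NonZero m}} → ℕ → ℕ × ℕ
lucasPairs m = fold (2 % m , 1 % m) (lucasStep m)

lucasMod : (m : ℕ) .{{_ : NonZero m}} → ℕ → ℕ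
lucasMod m n = proj₁ (lucasPairs m n)

L-mod-recurrence : ∀ m .{{_ : NonZero m}} n → L (suc (suc n)) % m ≡ (L (suc n) % m + L n % m) % m
L-mod-recurrence m n = %-distribˡ-+ (L (suc n)) (L n) m

lucasPairs-correct : ∀ m .{{_ : NonZero m}} n → lucasPairs m n ≡ (L n % m , L (suc n) % m)
lucasPairs-correct m zero = refl
lucasPairs-correct m (suc n) rewrite lucasPairs-correct m n =
  cong (L (suc n) % m ,_) (sym (L-mod-recurrence m n))

lucasMod-correct : ∀ m .{{_ : NonZero m}} n → lucasMod m n ≡ L n % m
lucasMod-correct m n = cong proj₁ (lucasPairs-correct m n)

-- If the initial residue pair recurs at index p, then L is p-periodic modulo m.
-- (The hypothesis is about computed residues, so it can be checked by evaluation.)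
lucas-periodic : ∀ m .{{_ : NonZero m}} p → lucasPairs m p ≡ lucasPairs m 0 →
                 ∀ n → L (n + p) % m ≡ L n % m
lucas-periodic m p recurs n = proj₁ (pairs n)
  where
  start : (L p % m , L (suc p) % m) ≡ (L 0 % m , L 1 % m)
  start = trans (sym (lucasPairs-correct m p)) (trans recurs (lucasPairs-correct m 0))

  pairs : ∀ n → L (n + p) % m ≡ L n % m × L (suc n + p) % m ≡ L (suc n) % m
  pairs zero = cong proj₁ start , cong proj₂ start
  pairs (suc n) with pairs n
  ... | e₀ , e₁ = e₁ , (begin
    L (suc (suc n) + p) % m                   ≡⟨ L-mod-recurrence m (n + p) ⟩
    (L (suc n + p) % m + L (n + p) % m) % m   ≡⟨ cong₂ (λ a b → (a + b) % m) e₁ e₀ ⟩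
    (L (suc n) % m + L n % m) % m             ≡⟨ sym (L-mod-recurrence m n) ⟩
    L (suc (suc n)) % m                       ∎)

power-periodic : ∀ m .{{_ : NonZero m}} a j k → a ^ (j + k) % m ≡ a ^ j % m →
                 ∀ n → a ^ (j + (n + k)) % m ≡ a ^ (j + n) % m
power-periodic m a j k cycle n = begin
  a ^ (j + (n + k)) % m                   ≡⟨ cong (λ e → a ^ e % m) (exponent-shuffle j n k) ⟩
  a ^ ((j + k) + n) % m                   ≡⟨ cong (_% m) (^-distribˡ-+-* a (j + k) n) ⟩
  (a ^ (j + k) * a ^ n) % m               ≡⟨ %-distribˡ-* (a ^ (j + k)) (a ^ n) m ⟩
  ((a ^ (j + k) % m) * (a ^ n % m)) % m   ≡⟨ cong (λ b → (b * (a ^ n % m)) % m) cycle ⟩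
  ((a ^ j % m) * (a ^ n % m)) % m         ≡⟨ sym (%-distribˡ-* (a ^ j) (a ^ n) m) ⟩
  (a ^ j * a ^ n) % m                     ≡⟨ cong (_% m) (sym (^-distribˡ-+-* a j n)) ⟩
  a ^ (j + n) % m                         ∎
  where
  exponent-shuffle : ∀ j n k → j + (n + k) ≡ (j + k) + n
  exponent-shuffle j n k = trans (cong (j +_) (+-comm n k)) (sym (+-assoc j k n))

L-positive : ∀ r → 1 ≤ L r
L-positive zero = s≤s z≤n
L-positive (suc zero) = s≤s z≤n
L-positive (suc (suc r)) = ≤-trans (L-positive (suc r)) (m≤m+n (L (suc r)) (L r))

L≡1⇒r≡1 : ∀ r → L r ≡ 1 → r ≡ 1
L≡1⇒r≡1 (suc zero) _ = refl
L≡1⇒r≡1 (suc (suc r)) e =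
  contradiction (subst (2 ≤_) e (+-mono-≤ (L-positive (suc r)) (L-positive r))) λ { (s≤s ()) }

M : ℕ
M = 276

L-mod-M : ∀ r → L r % M ≡ lucasMod M (r % 48)
L-mod-M r = trans (periodic-mod (λ n → L n % M) 48 (lucas-periodic M 48 refl) r)
                  (sym (lucasMod-correct M (r % 48)))

power-mod-M : ∀ a → a ^ 24 % M ≡ a ^ 2 % M → ∀ y → a ^ (2 + y) % M ≡ a ^ (2 + y % 22) % M
power-mod-M a cycle = periodic-mod (λ n → a ^ (2 + n) % M) 22 (power-periodic M a 2 22 cycle)

sieve : ∀ (k : Fin 48) (j : Fin 22) →
        (lucasMod M (toℕ k) + 2 ^ (2 + toℕ j) % M) % M ≢ 3 ^ (2 + toℕ j) % M
sieve = from-yes (all? {48} λ k → all? {22} λ j →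
          ¬? ((lucasMod M (toℕ k) + 2 ^ (2 + toℕ j) % M) % M ≟ 3 ^ (2 + toℕ j) % M))

no-solution-x≥2 : ∀ r y → 3 ^ (2 + y) ∸ 2 ^ (2 + y) ≢ L r
no-solution-x≥2 r y e = sieve (fromℕ< (m%n<n r 48)) (fromℕ< (m%n<n y 22)) congruence
  where
  x = 2 + y
  k = toℕ (fromℕ< (m%n<n r 48))
  j = toℕ (fromℕ< (m%n<n y 22))

  exact : L r + 2 ^ x ≡ 3 ^ x
  exact = trans (cong (_+ 2 ^ x) (sym e)) (m∸n+n≡m (^-monoˡ-≤ x (s≤s (s≤s z≤n))))

  congruence : (lucasMod M k + 2 ^ (2 + j) % M) % M ≡ 3 ^ (2 + j) % M
  congruence = begin
    (lucasMod M k + 2 ^ (2 + j) % M) % M           ≡⟨ cong₂ (λ a b → (lucasMod M a + 2 ^ (2 + b) % M) % M)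
                                                         (toℕ-fromℕ< (m%n<n r 48)) (toℕ-fromℕ< (m%n<n y 22)) ⟩
    (lucasMod M (r % 48) + 2 ^ (2 + y % 22) % M) % M ≡⟨ cong₂ (λ a b → (a + b) % M)
                                                         (sym (L-mod-M r)) (sym (power-mod-M 2 refl y)) ⟩
    (L r % M + 2 ^ x % M) % M                      ≡⟨ sym (%-distribˡ-+ (L r) (2 ^ x) M) ⟩
    (L r + 2 ^ x) % M                              ≡⟨ cong (_% M) exact ⟩
    3 ^ x % M                                      ≡⟨ power-mod-M 3 refl y ⟩
    3 ^ (2 + y % 22) % M                           ≡⟨ cong (λ b → 3 ^ (2 + b) % M) (sym (toℕ-fromℕ< (m%n<n y 22))) ⟩
    3 ^ (2 + j) % M                                ∎

solutions : ∀ r x → 3 ^ x ∸ 2 ^ x ≡ L r → (r ≡ 1) × (x ≡ 1)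
solutions r zero e = contradiction (subst (1 ≤_) (sym e) (L-positive r)) λ ()
solutions r (suc zero) e = L≡1⇒r≡1 r (sym e) , refl
solutions r (suc (suc y)) e = contradiction e (no-solution-x≥2 r y)

corollary2 : (r x : ℕ) → (3 ^ x ∸ 2 ^ x ≡ L r) ⇔ ((r ≡ 1) × (x ≡ 1))
corollary2 r x = mk⇔ (solutions r x) λ { (refl , refl) → refl }
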